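{- Let $\Gamma,\Delta$ be finite sets of implicational formulas. The sequent $\Gamma\vdash\Delta$ is derivable in the classical sequent calculus $\mathsf{LK}$ if and only if the judgment $\Gamma^{\mathsf p},\Delta^{\mathsf t}\vdash$ (with empty right-hand side) is derivable in the system $\mathsf{KT}$.
   Context: Formulas are implicational: $A::=X\mid A\to A$, with $X$ ranging over propositional atoms. $\mathsf{LK}$ here is Gentzen's classical sequent calculus for these formulas. For each formula $A$ there are two marked formulas: a proof formula $A^{\mathsf p}$ and a test formula $A^{\mathsf t}$. For a set $\Gamma=\{A_1,\dots,A_n\}$ write $\Gamma^{\mathsf p}=\{A_1^{\mathsf p},\dots,A_n^{\mathsf p}\}$ and $\Gamma^{\mathsf t}=\{A_1^{\mathsf t},\dots,A_n^{\mathsf t}\}$. Judgments of $\mathsf{KT}$ have the form $\Gamma\vdash\alpha$, where $\Gamma$ is a set of proof and test formulas and $\alpha$ is either empty, a proof formula, or a test formula. The rules of $\mathsf{KT}$ ($\Gamma$ is an arbitrary set of proof and test formulas) are: - Axioms: $\Gamma,A^{\mathsf p}\vdash A^{\mathsf p}$ and $\Gamma,A^{\mathsf t}\vdash A^{\mathsf t}$. - From $\Gamma,A^{\mathsf p},B^{\mathsf t}\vdash$ infer $\Gamma\vdash (A\to B)^{\mathsf p}$. - From $\Gamma\vdash A^{\mathsf p}$ and $\Gamma\vdash B^{\mathsf t}$ infer $\Gamma\vdash(A\to B)^{\mathsf t}$. - From $\Gamma,A^{\mathsf t}\vdash$ infer $\Gamma\vdash A^{\mathsf p}$. - From $\Gamma,A^{\mathsf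 p}\vdash$ infer $\Gamma\vdash A^{\mathsf t}$. - From $\Gamma\vdash A^{\mathsf t}$ and $\Gamma\vdash A^{\mathsf p}$ infer $\Gamma\vdash$. -}

module Defs where

open import Data.Nat using (ℕ)
open import Data.List using (List; []; _∷_; map; _++_)
open import Data.List.Membership.Propositional using (_∈_)
open import Data.List.Relation.Binary.Subset.Propositional using (_⊆_)
open import Data.Maybe using (Maybe; just; nothing)

infixr 30 _⇒_
data Formula : Set where
  atom : ℕ → Formula
  _⇒_  : Formula → Formula → Formula

-- Finite sets of formulas are represented by lists; the structural rule
-- 'struct' of LK (inclusion of both sides) makes order and multiplicity
-- irrelevant, i.e. it provides exchange, contraction and weakening.

infix 4 _⊢LK_
data _⊢LK_ : List Formula → List Formula → Set where
  ax     : ∀ {A} → (A ∷ []) ⊢LK (A ∷ [])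
  struct : ∀ {Γ Δ Γ′ Δ′} → Γ ⊢LK Δ → Γ ⊆ Γ′ → Δ ⊆ Δ′ → Γ′ ⊢LK Δ′
  ⇒L     : ∀ {Γ Δ A B} → Γ ⊢LK (A ∷ Δ) → (B ∷ Γ) ⊢LK Δ → ((A ⇒ B) ∷ Γ) ⊢LK Δ
  ⇒R     : ∀ {Γ Δ A B} → (A ∷ Γ) ⊢LK (B ∷ Δ) → Γ ⊢LK ((A ⇒ B) ∷ Δ)
  cut    : ∀ {Γ Δ A} → Γ ⊢LK (A ∷ Δ) → (A ∷ Γ) ⊢LK Δ → Γ ⊢LK Δ

data Marked : Set where
  _ᵖ : Formula → Marked
  _ᵗ : Formula → Marked

_ᵖˢ : List Formula → List Marked
Γ ᵖˢ = map _ᵖ Γ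

_ᵗˢ : List Formula → List Marked
Γ ᵗˢ = map _ᵗ Γ

-- The system KT.  The right-hand side is 'nothing' (empty) or 'just α'.
-- Contexts are lists read as sets (axioms use membership).
infix 4 _⊢KT_
data _⊢KT_ : List Marked → Maybe Marked → Set where
  axp  : ∀ {Γ A} → (A ᵖ) ∈ Γ → Γ ⊢KT just (A ᵖ)
  axt  : ∀ {Γ A} → (A ᵗ) ∈ Γ → Γ ⊢KT just (A ᵗ)
  ⇒p   : ∀ {Γ A B} → ((A ᵖ) ∷ (B ᵗ) ∷ Γ) ⊢KT nothing → Γ ⊢KT just ((A ⇒ B) ᵖ)
  ⇒t   : ∀ {Γ A B} → Γ ⊢KT just (A ᵖ) → Γ ⊢KT just (B ᵗ) → Γ ⊢KT just ((A ⇒ B) ᵗ)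
  tp   : ∀ {Γ A} → ((A ᵗ) ∷ Γ) ⊢KT nothing → Γ ⊢KT just (A ᵖ)
  pt   : ∀ {Γ A} → ((A ᵖ) ∷ Γ) ⊢KT nothing → Γ ⊢KT just (A ᵗ)
  clash : ∀ {Γ A} → Γ ⊢KT just (A ᵗ) → Γ ⊢KT just (A ᵖ) → Γ ⊢KT nothing

-- A marked context reads as an LK sequent: proof formulas on the left, test
-- formulas on the right. Under this reading ⇒p is ⇒R, ⇒t is ⇒L, clash is cut
-- and the KT axioms are weakened LK axioms. Conversely each LK rule is
-- simulated by a clash whose premises are obtained with tp and pt, the
-- structural rule being absorbed by letting the KT context be any superset.
module Submission where

open import Defs
open import Function using (_∘_)
open import Data.List using (List; []; _∷_; _++_)
open import Data.List.Membership.Propositional using (_∈_)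
open import Data.List.Relation.Binary.Subset.Propositional using (_⊆_)
open import Data.List.Relation.Binary.Subset.Propositional.Properties
  using (⊆-trans; map⁺; ∷⁺ʳ; xs⊆xs++ys; xs⊆ys++xs)
open import Data.List.Relation.Unary.Any using (here; there)
open import Data.Maybe using (Maybe; nothing; just)
open import Data.Product using (_×_; _,_)
open import Relation.Binary.PropositionalEquality using (_≡_; refl; cong; subst₂)

LK⇒KT : ∀ {Γ Δ Φ} → Γ ⊢LK Δ → Γ ᵖˢ ⊆ Φ → Δ ᵗˢ ⊆ Φ → Φ ⊢KT nothing
LK⇒KT ax Γ⊆Φ Δ⊆Φ = clash (axt (Δ⊆Φ (here refl))) (axp (Γ⊆Φ (here refl)))
LK⇒KT (struct d Γ⊆Γ′ Δ⊆Δ′) Γ⊆Φ Δ⊆Φ =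
  LK⇒KT d (⊆-trans (map⁺ _ᵖ Γ⊆Γ′) Γ⊆Φ) (⊆-trans (map⁺ _ᵗ Δ⊆Δ′) Δ⊆Φ)
LK⇒KT (⇒L d e) Γ⊆Φ Δ⊆Φ =
  clash (⇒t (tp (LK⇒KT d (there ∘ Γ⊆Φ ∘ there) (∷⁺ʳ _ Δ⊆Φ)))
            (pt (LK⇒KT e (∷⁺ʳ _ (Γ⊆Φ ∘ there)) (there ∘ Δ⊆Φ))))
        (axp (Γ⊆Φ (here refl)))
LK⇒KT (⇒R d) Γ⊆Φ Δ⊆Φ =
  clash (axt (Δ⊆Φ (here refl)))
        (⇒p (LK⇒KT d (∷⁺ʳ _ (there ∘ Γ⊆Φ)) (there ∘ ∷⁺ʳ _ (Δ⊆Φ ∘ there))))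
LK⇒KT (cut d e) Γ⊆Φ Δ⊆Φ =
  clash (pt (LK⇒KT e (∷⁺ʳ _ Γ⊆Φ) (there ∘ Δ⊆Φ)))
        (tp (LK⇒KT d (there ∘ Γ⊆Φ) (∷⁺ʳ _ Δ⊆Φ)))

proofs : List Marked → List Formula
proofs []          = []
proofs ((A ᵖ) ∷ Φ) = A ∷ proofs Φ
proofs ((A ᵗ) ∷ Φ) = proofs Φ

tests : List Marked → List Formula
tests []          = []
tests ((A ᵖ) ∷ Φ) = tests Φ
tests ((A ᵗ) ∷ Φ) = A ∷ tests Φ

-- Φ ⊢ A ᵖ is read as Φ, A ᵗ ⊢ and dually, which makes tp and pt identities.
complement : Maybe Marked → List Marked
complement nothing       = []
complement (just (A ᵖ)) = (A ᵗ) ∷ []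
complement (just (A ᵗ)) = (A ᵖ) ∷ []

asLK : List Marked → Set
asLK Φ = proofs Φ ⊢LK tests Φ

∈-proofs : ∀ {A Φ} → (A ᵖ) ∈ Φ → A ∈ proofs Φ
∈-proofs {Φ = (_ ᵖ) ∷ _} (here refl) = here refl
∈-proofs {Φ = (_ ᵖ) ∷ _} (there A∈Φ) = there (∈-proofs A∈Φ)
∈-proofs {Φ = (_ ᵗ) ∷ _} (there A∈Φ) = ∈-proofs A∈Φ

∈-tests : ∀ {A Φ} → (A ᵗ) ∈ Φ → A ∈ tests Φ
∈-tests {Φ = (_ ᵗ) ∷ _} (here refl) = here refl
∈-tests {Φ = (_ ᵗ) ∷ _} (there A∈Φ) = there (∈-tests A∈Φ)
∈-tests {Φ = (_ ᵖ) ∷ _} (there A∈Φ) = ∈-tests A∈Φ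

proofs-ᵖˢ++ᵗˢ : ∀ Γ Δ → proofs (Γ ᵖˢ ++ Δ ᵗˢ) ≡ Γ
proofs-ᵖˢ++ᵗˢ []      []      = refl
proofs-ᵖˢ++ᵗˢ []      (_ ∷ Δ) = proofs-ᵖˢ++ᵗˢ [] Δ
proofs-ᵖˢ++ᵗˢ (A ∷ Γ) Δ       = cong (A ∷_) (proofs-ᵖˢ++ᵗˢ Γ Δ)

tests-ᵖˢ++ᵗˢ : ∀ Γ Δ → tests (Γ ᵖˢ ++ Δ ᵗˢ) ≡ Δ
tests-ᵖˢ++ᵗˢ []      []      = refl
tests-ᵖˢ++ᵗˢ []      (A ∷ Δ) = cong (A ∷_) (tests-ᵖˢ++ᵗˢ [] Δ)
tests-ᵖˢ++ᵗˢ (_ ∷ Γ) Δ       = tests-ᵖˢ++ᵗˢ Γ Δ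

axiom-∈ : ∀ {A Γ Δ} → A ∈ Γ → A ∈ Δ → Γ ⊢LK Δ
axiom-∈ A∈Γ A∈Δ = struct ax (λ { (here refl) → A∈Γ }) (λ { (here refl) → A∈Δ })

KT⇒LK : ∀ {Φ α} → Φ ⊢KT α → asLK (complement α ++ Φ)
KT⇒LK (axp A∈Φ)   = axiom-∈ (∈-proofs A∈Φ) (here refl)
KT⇒LK (axt A∈Φ)   = axiom-∈ (here refl) (∈-tests A∈Φ)
KT⇒LK (⇒p d)      = ⇒R (KT⇒LK d)
KT⇒LK (⇒t d e)    = ⇒L (KT⇒LK d) (KT⇒LK e)
KT⇒LK (tp d)      = KT⇒LK d
KT⇒LK (pt d)      = KT⇒LK d
KT⇒LK (clash d e) = cut (KT⇒LK e) (KT⇒LK d)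

proposition1 : (Γ Δ : List Formula) →
    ((Γ ⊢LK Δ) → ((Γ ᵖˢ) ++ (Δ ᵗˢ)) ⊢KT nothing) × ((((Γ ᵖˢ) ++ (Δ ᵗˢ)) ⊢KT nothing) → Γ ⊢LK Δ)
proposition1 Γ Δ =
  (λ d → LK⇒KT d (xs⊆xs++ys (Γ ᵖˢ) (Δ ᵗˢ)) (xs⊆ys++xs (Δ ᵗˢ) (Γ ᵖˢ))) ,
  (λ d → subst₂ _⊢LK_ (proofs-ᵖˢ++ᵗˢ Γ Δ) (tests-ᵖˢ++ᵗˢ Γ Δ) (KT⇒LK d))
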